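{- Let $x=x[0]x[1]\cdots x[n-1]$ be a word and let $aub$, with $a,b$ letters and $u$ a (possibly empty) word, be a factor occurring exactly once in $x$. The following are equivalent: (1) $aub$ is a prefix of some minimal absent word of $x$; (2) $ub$ occurs at least twice in $x$, and, if $j_1<j_2<\dots<j_k$ are the starting positions of its occurrences in $x$ and $j_m-1$ is the starting position of the (unique) occurrence of $aub$, then at least one of the following holds: (i) $x[j_m+k']\neq x[j_i+k']$ for some $i$ and $k'$ with $j_m+k'\le n-1$ and $j_i+k'\le n-1$; (ii) $m\neq 1$.
   Context: Positions in $x$ are 0-indexed. A word $w$ is a minimal absent word of $x$ if $w$ is not a factor (contiguous substring) of $x$ but every proper factor of $w$ is a factor of $x$. -}

module Defs where

open import Data.Nat using (ℕ; suc; _+_; _<_)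
open import Data.List using (List; []; _∷_; _++_; [_]; take; drop; length; lookup)
open import Data.Fin using (fromℕ<)
open import Data.Product using (Σ; ∃; ∃-syntax; _×_)
open import Relation.Binary.PropositionalEquality using (_≡_; _≢_)
open import Relation.Nullary using (¬_)

module _ {A : Set} where

  OccursAt : List A → List A → ℕ → Set
  OccursAt w x j = take (length w) (drop j x) ≡ w

  Factor : List A → List A → Set
  Factor w x = ∃[ j ] OccursAt w x j

  ProperFactor : List A → List A → Set
  ProperFactor v w = Factor v w × v ≢ w

  MinimalAbsentWord : List A → List A → Set
  MinimalAbsentWord w x =
    ¬ Factor w x × (∀ v → ProperFactor v w → Factor v x)

  Prefix : List A → List A → Set
  Prefix p w = ∃[ v ] w ≡ p ++ v

  Mismatch : List A → ℕ → ℕ → Set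
  Mismatch x i i' =
    Σ (i < length x) λ p → Σ (i' < length x) λ q →
      lookup x (fromℕ< p) ≢ lookup x (fromℕ< q)

module Submission where

-- Write S for the suffix of x that follows the letter a of the
-- unique occurrence of a·y (where y = u·b), i.e. S = x[p+1..].  Every occurrence of
-- a word a·v with y ≼ v is that occurrence, so v is then a prefix of S.  Hence
-- a·m·d is a minimal absent word extending a·y exactly when there is a
-- "branch": m extends y, m is a prefix of S, m·d occurs somewhere (at j, say)
-- but m·d is not a prefix of S.  Both conditions of the theorem are then
-- read off from branches:
--   * a branch at j gives a second occurrence of y at j ≠ p+1, and either
--     j < p+1 or (j > p+1 and) x[p+1+|m|] ≠ x[j+|m|];
--   * conversely, an occurrence of y at j with a mismatch, or with j < p+1,
--     has a suffix x[j..] that is not a prefix of S, and walking along the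
--     longest common prefix of x[j..] and S produces a branch.

open import Defs
open import Data.Nat using (ℕ; zero; suc; _+_; _<_; _≤_; z≤n; s≤s)
open import Data.Nat.Properties using (<-cmp; <⇒≤; <⇒≱; ≤-trans; ∸-monoʳ-<)
open import Data.List using (List; []; _∷_; _++_; [_]; take; drop; length; lookup; initLast; _∷ʳ′_)
open import Data.List.Properties
  using (++-assoc; ++-identityʳ; ++-cancelˡ; take++drop≡id; ∷-injectiveˡ; ∷-injectiveʳ; length-++-≤ˡ; length-++-≤ʳ; length-drop; drop-drop)
open import Data.Fin using (fromℕ<)
open import Data.Product using (∃-syntax; _×_; _,_; proj₁; proj₂)
open import Data.Sum using (_⊎_; inj₁; inj₂; [_,_]′)
open import Data.Empty using (⊥-elim)
open import Function using (_∘_)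
open import Function.Bundles using (_⇔_; mk⇔; Equivalence)
open import Relation.Binary using (DecidableEquality; Tri; tri<; tri≈; tri>)
open import Relation.Binary.PropositionalEquality using (_≡_; _≢_; refl; sym; trans; cong; subst; subst₂)
open import Relation.Nullary using (¬_; yes; no)

module _ {A : Set} where

  prefix-trans : ∀ {u v w : List A} → Prefix u v → Prefix v w → Prefix u w
  prefix-trans {u} (r , refl) (s , refl) = r ++ s , ++-assoc u r s

  prefix-++⁺ : ∀ (c : List A) {u w} → Prefix u w → Prefix (c ++ u) (c ++ w)
  prefix-++⁺ c {u} (r , refl) = r , sym (++-assoc c u r)

  prefix-++⁻ : ∀ (c : List A) {u w} → Prefix (c ++ u) (c ++ w) → Prefix u w
  prefix-++⁻ c {u} (r , eq) = r , ++-cancelˡ c _ _ (trans eq (++-assoc c u r))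

  prefix-drop : ∀ i {u w : List A} → Prefix u w → Prefix (drop i u) (drop i w)
  prefix-drop zero pre = pre
  prefix-drop (suc i) {[]} (r , refl) = drop (suc i) r , refl
  prefix-drop (suc i) {e ∷ u} (r , refl) = prefix-drop i (r , refl)

  prefix-length : ∀ {u w : List A} → Prefix u w → length u ≤ length w
  prefix-length {u} (r , refl) = length-++-≤ˡ u

  prefix-of-snoc : ∀ {v} (y : List A) {c} → Prefix v (y ++ [ c ]) → v ≢ y ++ [ c ] → Prefix v y
  prefix-of-snoc {[]} y _ _ = y , refl
  prefix-of-snoc {e ∷ []} [] (_ , refl) v≢ = ⊥-elim (v≢ refl)
  prefix-of-snoc {e ∷ _ ∷ _} [] (_ , ())
  prefix-of-snoc {e ∷ v} (f ∷ y) (r , eq) v≢ with refl ← ∷-injectiveˡ eq =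
    prefix-++⁺ [ e ] (prefix-of-snoc y (r , ∷-injectiveʳ eq) (v≢ ∘ cong (e ∷_)))

  take-length-++ : ∀ (w r : List A) → take (length w) (w ++ r) ≡ w
  take-length-++ [] r = refl
  take-length-++ (e ∷ w) r = cong (e ∷_) (take-length-++ w r)

  occurs⇒prefix : ∀ {w : List A} x j → OccursAt w x j → Prefix w (drop j x)
  occurs⇒prefix {w} x j o =
    drop (length w) (drop j x) ,
    trans (sym (take++drop≡id (length w) (drop j x)))
          (cong (_++ drop (length w) (drop j x)) o)

  prefix⇒occurs : ∀ {w : List A} x j → Prefix w (drop j x) → OccursAt w x j
  prefix⇒occurs {w} x j (r , eq) = trans (cong (take (length w)) eq) (take-length-++ w r)

  prefix⇒factor : ∀ {v w : List A} → Prefix v w → Factor v w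
  prefix⇒factor {w = w} pre = 0 , prefix⇒occurs w 0 pre

  factor-trans : ∀ {v y x : List A} → Factor v y → Factor y x → Factor v x
  factor-trans {v} {y} {x} (i , oi) (j , oj) =
    j + i , prefix⇒occurs x (j + i) (subst (Prefix v) (drop-drop j i x)
                             (prefix-trans (occurs⇒prefix y i oi) (prefix-drop i (occurs⇒prefix x j oj))))

  drop-∷ : ∀ p (x : List A) {e r} → drop p x ≡ e ∷ r → drop (suc p) x ≡ r
  drop-∷ zero (f ∷ x) refl = refl
  drop-∷ (suc p) (f ∷ x) eq = drop-∷ p x eq
  drop-∷ zero [] ()
  drop-∷ (suc p) [] ()

  prefix-∷-drop : ∀ {e w} p (x : List A) → Prefix (e ∷ w) (drop p x) →
                  drop p x ≡ e ∷ drop (suc p) x × Prefix w (drop (suc p) x)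
  prefix-∷-drop {e} p x (r , eq) =
    trans eq (cong (e ∷_) (sym (drop-∷ p x eq))) , r , drop-∷ p x eq

  drop-nonempty⇒< : ∀ j (x : List A) → 0 < length (drop j x) → j < length x
  drop-nonempty⇒< zero (e ∷ x) _ = s≤s z≤n
  drop-nonempty⇒< (suc j) (e ∷ x) h = s≤s (drop-nonempty⇒< j x h)

  drop-∷⇒< : ∀ j (x : List A) {e r} → drop j x ≡ e ∷ r → j < length x
  drop-∷⇒< j x eq = drop-nonempty⇒< j x (subst (λ z → 0 < length z) (sym eq) (s≤s z≤n))

  suffix-shorter : ∀ {i j} (x : List A) → i < j → j ≤ length x → length (drop j x) < length (drop i x)
  suffix-shorter {i} {j} x i<j j≤ =
    subst₂ _<_ (sym (length-drop j x)) (sym (length-drop i x)) (∸-monoʳ-< i<j j≤)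

  drop-length-++ : ∀ (m z : List A) → drop (length m) (m ++ z) ≡ z
  drop-length-++ [] z = refl
  drop-length-++ (e ∷ m) z = drop-length-++ m z

  drop-lookup : ∀ {n} (x : List A) (h : n < length x) → drop n x ≡ lookup x (fromℕ< h) ∷ drop (suc n) x
  drop-lookup {zero} (e ∷ x) _ = refl
  drop-lookup {suc n} (e ∷ x) (s≤s h) = drop-lookup x h

  mismatch-intro : ∀ {x : List A} {i j e f r r'} → drop i x ≡ e ∷ r → drop j x ≡ f ∷ r' → e ≢ f → Mismatch x i j
  mismatch-intro {x} {i} {j} di dj e≢f =
    hi , hj , λ eq → e≢f (trans (sym (head-at di hi)) (trans eq (head-at dj hj)))
    where
    hi = drop-∷⇒< i x di
    hj = drop-∷⇒< j x dj
    head-at : ∀ {k e r} → drop k x ≡ e ∷ r → (h : k < length x) → lookup x (fromℕ< h) ≡ e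
    head-at dk h = ∷-injectiveˡ (trans (sym (drop-lookup x h)) dk)

  mismatch⇒¬prefix : ∀ {x : List A} i j k → Mismatch x (i + k) (j + k) → ¬ Prefix (drop j x) (drop i x)
  mismatch⇒¬prefix {x} i j k (hi , hj , differ) pre = differ (∷-injectiveˡ (proj₂ heads))
    where
    shifted : Prefix (drop (j + k) x) (drop (i + k) x)
    shifted = subst₂ Prefix (drop-drop j k x) (drop-drop i k x) (prefix-drop k pre)
    heads = subst₂ Prefix (drop-lookup x hj) (drop-lookup x hi) shifted

  mismatch-at-branch : ∀ {x : List A} {i j m c} → i < j → Prefix m (drop i x) →
    Prefix (m ++ [ c ]) (drop j x) → ¬ Prefix (m ++ [ c ]) (drop i x) →
    Mismatch x (i + length m) (j + length m)
  mismatch-at-branch {x} {i} {j} {m} {c} i<j ([] , di) mc≼Tj _ =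
    ⊥-elim (<⇒≱ (suffix-shorter x i<j (<⇒≤ j<len)) (prefix-length Ti≼Tj))
    where
    j<len = drop-nonempty⇒< j x (≤-trans (length-++-≤ʳ [ c ] {m}) (prefix-length mc≼Tj))
    Ti≼Tj = prefix-trans (subst (λ z → Prefix z (m ++ [ c ])) (sym di) (prefix-++⁺ m ([ c ] , refl))) mc≼Tj
  mismatch-at-branch {x} {i} {j} {m} {c} i<j (e ∷ r , di) (r' , dj) mc⋠Ti =
    mismatch-intro (after-m i di) (after-m j (trans dj (++-assoc m [ c ] r'))) e≢c
    where
    after-m : ∀ k {z} → drop k x ≡ m ++ z → drop (k + length m) x ≡ z
    after-m k {z} dk = trans (sym (drop-drop k (length m) x)) (trans (cong (drop (length m)) dk) (drop-length-++ m z))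
    e≢c : e ≢ c
    e≢c refl = mc⋠Ti (r , trans di (sym (++-assoc m [ e ] r)))

  -- Minimal absent words of length ≥ 2: a·m·c is one iff it is absent
  -- while a·m and m·c are present (every proper factor lies in one of these).

  ≢-snoc : ∀ (m : List A) c → m ≢ m ++ [ c ]
  ≢-snoc [] c ()
  ≢-snoc (e ∷ m) c eq = ≢-snoc m c (∷-injectiveʳ eq)

  ≢-∷ : ∀ e (y : List A) → y ≢ e ∷ y
  ≢-∷ e [] ()
  ≢-∷ e (f ∷ y) eq = ≢-∷ f y (∷-injectiveʳ eq)

  proper-factor-split : ∀ {v : List A} a m c → ProperFactor v (a ∷ m ++ [ c ]) →
                        Factor v (a ∷ m) ⊎ Factor v (m ++ [ c ])
  proper-factor-split a m c ((zero , o) , v≢) = inj₁ (prefix⇒factor (prefix-of-snoc (a ∷ m) (occurs⇒prefix (a ∷ m ++ [ c ]) 0 o) v≢))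
  proper-factor-split a m c ((suc i , o) , _) = inj₂ (i , o)

  maw-∷-snoc : ∀ {x : List A} a m c → MinimalAbsentWord (a ∷ m ++ [ c ]) x ⇔
               (¬ Factor (a ∷ m ++ [ c ]) x × Factor (a ∷ m) x × Factor (m ++ [ c ]) x)
  maw-∷-snoc a m c = mk⇔
    (λ (absent , minimal) →
      absent ,
      minimal (a ∷ m) (prefix⇒factor ([ c ] , refl) , ≢-snoc (a ∷ m) c) ,
      minimal (m ++ [ c ]) ((1 , prefix⇒occurs (a ∷ m ++ [ c ]) 1 ([] , sym (++-identityʳ _))) , ≢-∷ a (m ++ [ c ])))
    (λ (absent , left , right) →
      absent , λ v proper →
        [ (λ f → factor-trans f left) , (λ f → factor-trans f right) ]′ (proper-factor-split a m c proper))

  divergence : DecidableEquality A → ∀ (s t : List A) → ¬ Prefix t s →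
    ∃[ v ] ∃[ d ] (Prefix v s × Prefix (v ++ [ d ]) t × ¬ Prefix (v ++ [ d ]) s)
  divergence _ s [] t⋠s = ⊥-elim (t⋠s (s , refl))
  divergence _ [] (d ∷ t) _ = [] , d , (_ , refl) , (t , refl) , λ ()
  divergence eq? (e ∷ s) (d ∷ t) t⋠s with eq? e d
  ... | no e≢d = [] , d , (_ , refl) , (t , refl) , λ (_ , eq) → e≢d (∷-injectiveˡ eq)
  ... | yes refl with divergence eq? s t (t⋠s ∘ prefix-++⁺ [ e ])
  ...   | v , d' , v≼s , vd≼t , vd⋠s = e ∷ v , d' , prefix-++⁺ [ e ] v≼s , prefix-++⁺ [ e ] vd≼t , vd⋠s ∘ prefix-++⁻ [ e ]

  divergence-after : DecidableEquality A → ∀ {c s t : List A} → Prefix c s → Prefix c t → ¬ Prefix t s →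
    ∃[ m ] ∃[ d ] (Prefix c m × Prefix m s × Prefix (m ++ [ d ]) t × ¬ Prefix (m ++ [ d ]) s)
  divergence-after eq? {c} (s' , refl) (t' , refl) t⋠s
    with divergence eq? s' t' (t⋠s ∘ prefix-++⁺ c)
  ... | v , d , v≼s' , vd≼t' , vd⋠s' =
    c ++ v , d , (v , refl) , prefix-++⁺ c v≼s' ,
    subst (λ z → Prefix z (c ++ t')) (sym (++-assoc c v [ d ])) (prefix-++⁺ c vd≼t') ,
    vd⋠s' ∘ prefix-++⁻ c ∘ subst (λ z → Prefix z (c ++ s')) (++-assoc c v [ d ])

  module UniqueOccurrence (x : List A) (a : A) (y : List A) (p : ℕ)
           (occ : OccursAt (a ∷ y) x p)
           (unique : ∀ q → OccursAt (a ∷ y) x q → q ≡ p) where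

    S : List A
    S = drop (suc p) x

    suffix-at-p : drop p x ≡ a ∷ S
    suffix-at-p = proj₁ (prefix-∷-drop p x (occurs⇒prefix x p occ))

    y≼S : Prefix y S
    y≼S = proj₂ (prefix-∷-drop p x (occurs⇒prefix x p occ))

    anchored : ∀ {v} → Prefix y v → Factor (a ∷ v) x → Prefix v S
    anchored {v} y≼v (l , o) = prefix-++⁻ [ a ] (subst (Prefix (a ∷ v)) drop-l≡ (occurs⇒prefix x l o))
      where
      drop-l≡ : drop l x ≡ a ∷ S
      drop-l≡ = trans (cong (λ q → drop q x) (unique l (prefix⇒occurs x l
                  (prefix-trans (prefix-++⁺ [ a ] y≼v) (occurs⇒prefix x l o))))) suffix-at-p

    following : ∀ {v} → Prefix v S → Factor (a ∷ v) x
    following {v} v≼S = p , prefix⇒occurs x p (subst (Prefix (a ∷ v)) (sym suffix-at-p) (prefix-++⁺ [ a ] v≼S))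

    Branch : Set
    Branch = ∃[ m ] ∃[ d ] ∃[ j ]
      (Prefix y m × Prefix m S × Prefix (m ++ [ d ]) (drop j x) × ¬ Prefix (m ++ [ d ]) S)

    -- Condition (2) of the theorem: y occurs twice, and (i) or (ii) holds.
    TwoOccurrences : Set
    TwoOccurrences = ∃[ j ] ∃[ j' ] (j ≢ j' × OccursAt y x j × OccursAt y x j')

    Distinguished : Set
    Distinguished = (∃[ ji ] ∃[ k' ] (OccursAt y x ji × Mismatch x (suc p + k') (ji + k')))
                    ⊎ (∃[ j₁ ] (j₁ < suc p × OccursAt y x j₁))

    -- A minimal absent word a·y·v has v = v₀·c, and (y·v₀, c) is a branch.
    maw⇒branch : ∃[ w ] (MinimalAbsentWord w x × Prefix (a ∷ y) w) → Branch
    maw⇒branch (_ , maw , v , refl) with initLast v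
    ... | [] = ⊥-elim (proj₁ maw (following (subst (λ z → Prefix z S) (sym (++-identityʳ y)) y≼S)))
    ... | v₀ ∷ʳ′ c
      with absent , left , right ← Equivalence.to (maw-∷-snoc a (y ++ v₀) c)
             (subst (λ z → MinimalAbsentWord (a ∷ z) x) (sym (++-assoc y v₀ [ c ])) maw) =
      y ++ v₀ , c , proj₁ right , (v₀ , refl) , anchored (v₀ , refl) left ,
      occurs⇒prefix x (proj₁ right) (proj₂ right) , absent ∘ following

    branch⇒maw : Branch → ∃[ w ] (MinimalAbsentWord w x × Prefix (a ∷ y) w)
    branch⇒maw (m , d , j , y≼m , m≼S , md≼Tj , md⋠S) =
      a ∷ m ++ [ d ] ,
      Equivalence.from (maw-∷-snoc a m d)
        (md⋠S ∘ anchored y≼md , following m≼S , (j , prefix⇒occurs x j md≼Tj)) ,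
      prefix-++⁺ [ a ] y≼md
      where
      y≼md = prefix-trans y≼m ([ d ] , refl)

    -- Occurrences at j and p+1; compare j with p+1 to get (i) or (ii).
    branch⇒conditions : Branch → TwoOccurrences × Distinguished
    branch⇒conditions (m , d , j , y≼m , m≼S , md≼Tj , md⋠S) =
      (j , suc p , j≢1+p , occ-j , prefix⇒occurs x (suc p) y≼S) , by-position (<-cmp j (suc p))
      where
      occ-j = prefix⇒occurs x j (prefix-trans y≼m (prefix-trans ([ d ] , refl) md≼Tj))
      j≢1+p : j ≢ suc p
      j≢1+p refl = md⋠S md≼Tj
      by-position : Tri (j < suc p) (j ≡ suc p) (suc p < j) → Distinguished
      by-position (tri< j<1+p _ _) = inj₂ (j , j<1+p , occ-j)
      by-position (tri≈ _ j≡1+p _) = ⊥-elim (j≢1+p j≡1+p)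
      by-position (tri> _ _ 1+p<j) = inj₁ (j , length m , occ-j , mismatch-at-branch 1+p<j m≼S md≼Tj md⋠S)

    escaping : Distinguished → ∃[ j ] (OccursAt y x j × ¬ Prefix (drop j x) S)
    escaping (inj₁ (j , k , o , mismatch)) = j , o , mismatch⇒¬prefix (suc p) j k mismatch
    escaping (inj₂ (j , j<1+p , o)) =
      j , o , λ Tj≼S → <⇒≱ (suffix-shorter x j<1+p (drop-∷⇒< p x suffix-at-p)) (prefix-length Tj≼S)

    -- The longest common prefix of x[j..] and S, past y, ends in a branch.
    distinguished⇒branch : DecidableEquality A → Distinguished → Branch
    distinguished⇒branch eq? dist with j , o , Tj⋠S ← escaping dist
      with m , d , y≼m , m≼S , md≼Tj , md⋠S ← divergence-after eq? y≼S (occurs⇒prefix x j o) Tj⋠S =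
      m , d , j , y≼m , m≼S , md≼Tj , md⋠S

lemma6 : {A : Set} → DecidableEquality A →
    (x : List A) (a b : A) (u : List A) (p : ℕ) →
    OccursAt (a ∷ u ++ [ b ]) x p →
    (∀ q → OccursAt (a ∷ u ++ [ b ]) x q → q ≡ p) →
    (∃[ w ] (MinimalAbsentWord w x × Prefix (a ∷ u ++ [ b ]) w))
    ⇔
    ((∃[ j ] ∃[ j' ] (j ≢ j' × OccursAt (u ++ [ b ]) x j
                             × OccursAt (u ++ [ b ]) x j'))
     × ((∃[ ji ] ∃[ k' ] (OccursAt (u ++ [ b ]) x ji
                          × Mismatch x (suc p + k') (ji + k')))
        ⊎ (∃[ j₁ ] (j₁ < suc p × OccursAt (u ++ [ b ]) x j₁))))
lemma6 eq? x a b u p occ unique =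
  mk⇔ (branch⇒conditions ∘ maw⇒branch) (branch⇒maw ∘ distinguished⇒branch eq? ∘ proj₂)
  where open UniqueOccurrence x a (u ++ [ b ]) p occ unique
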